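{- Define $h_\infty(k)=\sum_{i=1}^{\infty}\frac{(-1)^{i+1}(k-2)!}{(k-2+i)!}$ for integers $k\ge 2$. Then for all integers $k\ge 2$: (A1) $h_\infty(k+1)\le h_\infty(k)$; (A2) $0\le h_\infty(k)\le 1/(k-1+1/k)$; (A3) $h_\infty(k+1)\le 1-(k-1)h_\infty(k)$. -}

module Defs where

open import Data.Nat using (ℕ; zero; suc; _∸_; _≥_) renaming (_+_ to _+ℕ_)
open import Data.Nat.Combinatorics using ()
open import Data.Nat.Base using (_!)
open import Data.Nat.Properties using (_!≢0)
open import Data.Integer using (+_)
open import Data.Rational using (ℚ; 0ℚ; 1ℚ; _+_; _*_; -_; _/_; _≤_; Positive)
open import Data.Product using (∃; Σ)

-- (-1)^(i+1) as a rational: altSign 1 = 1, altSign 2 = -1, ...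
altSign : ℕ → ℚ
altSign zero    = - 1ℚ
altSign (suc i) = - altSign i

hTerm : ℕ → ℕ → ℚ
hTerm k i = altSign i * ((+ ((k ∸ 2) !)) / ((k ∸ 2 +ℕ i) !)) {{(k ∸ 2 +ℕ i) !≢0}}

hPartial : ℕ → ℕ → ℚ
hPartial k zero    = 0ℚ
hPartial k (suc n) = hPartial k n + hTerm k (suc n)

-- Inequality between the limits of two (convergent) rational sequences:
-- lim a ≤ lim b  iff  ∀ ε > 0, ∃ N, ∀ n ≥ N, a n ≤ b n + ε.
LimLe : (ℕ → ℚ) → (ℕ → ℚ) → Set
LimLe a b = ∀ (ε : ℚ) → Positive ε → ∃ λ N → ∀ n → n ≥ N → a n ≤ b n + ε

const : ℚ → ℕ → ℚ
const q _ = q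

module Submission where

-- Write k = m + 2 and a i = m! / (m + i)!, so h_∞(k) is the alternating series of the nonnegative,
-- decreasing a i. By Leibniz's estimate every partial sum S n with n ≥ 1 lies between S 2 = 1/k and
-- S 3 = S 2 + a 3, and consecutive partial sums differ by a (n + 1) ≤ 1/(n + 1). The terms for k + 1
-- are (k − 1) a (i + 1) and (k − 1) a 1 = 1, whence the recurrence S_{k+1} n = 1 − (k − 1) S_k (n + 1).
-- It gives (A3) up to the error (k − 1) a (n + 1), and (A1) because 1 − (k − 1) y ≤ y once y ≥ 1/k.
-- For (A2), S 2 + a 3 = k/(k² − 1) ≤ k/(k² − k + 1). Each inequality between limits thus comes from
-- a pointwise inequality between partial sums up to an error O(1/n).

open import Defs
open import Data.Nat using (ℕ; suc; _≤_; _∸_; _*_)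
open import Data.Integer using (+_)
open import Data.Rational using (ℚ; 0ℚ; 1ℚ; _+_; -_; _/_) renaming (_*_ to _*ℚ_)
open import Data.Product using (_×_; _,_; proj₁; proj₂; ∃)
open import Data.Sum using (_⊎_; inj₁; inj₂)

import Data.Nat as ℕ
import Data.Nat.Properties as ℕ
import Data.Integer as ℤ
import Data.Integer.Properties as ℤ
import Data.Rational as ℚ
import Data.Rational.Properties as ℚ
import Data.Rational.Unnormalised as ℚᵘ
import Data.Rational.Unnormalised.Properties as ℚᵘ
open import Relation.Binary.PropositionalEquality
open import Function using (_∘_)
open import Data.Nat.Base using (_!)
open import Data.Nat.Properties using (_!≢0)
open import Data.Nat.Tactic.RingSolver using (solve-∀) renaming (solve to solveℕ)
open import Data.List using ([]; _∷_)
open import Data.Rational.Solver using (module +-*-Solver)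
open +-*-Solver using (solve; _:=_; _:+_; _:*_; :-_; _:-_; con)

toℚᵘ-/ : ∀ a b → ℚ.toℚᵘ (+ a / suc b) ℚᵘ.≃ ℚᵘ.mkℚᵘ (+ a) b
toℚᵘ-/ a b = ℚ.toℚᵘ-fromℚᵘ (ℚᵘ.mkℚᵘ (+ a) b)

/-≡ : ∀ a b c d .{{_ : ℕ.NonZero b}} .{{_ : ℕ.NonZero d}} →
      a ℕ.* d ≡ c ℕ.* b → + a / b ≡ + c / d
/-≡ a (suc b) c (suc d) ad≡cb = ℚ.toℚᵘ-injective (begin
  ℚ.toℚᵘ (+ a / suc b)  ≈⟨ toℚᵘ-/ a b ⟩
  ℚᵘ.mkℚᵘ (+ a) b       ≈⟨ ℚᵘ.*≡* cross ⟩
  ℚᵘ.mkℚᵘ (+ c) d       ≈⟨ toℚᵘ-/ c d ⟨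
  ℚ.toℚᵘ (+ c / suc d)  ∎)
  where
  open ℚᵘ.≃-Reasoning
  cross : + a ℤ.* + suc d ≡ + c ℤ.* + suc b
  cross = trans (sym (ℤ.pos-* a (suc d))) (trans (cong +_ ad≡cb) (ℤ.pos-* c (suc b)))

/-≤ : ∀ a b c d .{{_ : ℕ.NonZero b}} .{{_ : ℕ.NonZero d}} →
      a ℕ.* d ℕ.≤ c ℕ.* b → + a / b ℚ.≤ + c / d
/-≤ a (suc b) c (suc d) ad≤cb = ℚ.toℚᵘ-cancel-≤ (begin
  ℚ.toℚᵘ (+ a / suc b)  ≃⟨ toℚᵘ-/ a b ⟩
  ℚᵘ.mkℚᵘ (+ a) b       ≤⟨ ℚᵘ.*≤* cross ⟩
  ℚᵘ.mkℚᵘ (+ c) d       ≃⟨ toℚᵘ-/ c d ⟨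
  ℚ.toℚᵘ (+ c / suc d)  ∎)
  where
  open ℚᵘ.≤-Reasoning
  cross : + a ℤ.* + suc d ℤ.≤ + c ℤ.* + suc b
  cross = subst₂ ℤ._≤_ (ℤ.pos-* a (suc d)) (ℤ.pos-* c (suc b)) (ℤ.+≤+ ad≤cb)

/-* : ∀ a b c d .{{_ : ℕ.NonZero b}} .{{_ : ℕ.NonZero d}} →
      (+ a / b) *ℚ (+ c / d) ≡ (+ (a ℕ.* c) / (b ℕ.* d)) {{ℕ.m*n≢0 b d}}
/-* a b@(suc b-1) c d@(suc d-1) = ℚ.toℚᵘ-injective (begin
  ℚ.toℚᵘ ((+ a / b) *ℚ (+ c / d))                   ≈⟨ ℚ.toℚᵘ-homo-* (+ a / b) (+ c / d) ⟩
  ℚ.toℚᵘ (+ a / b) ℚᵘ.* ℚ.toℚᵘ (+ c / d)            ≈⟨ ℚᵘ.*-cong (toℚᵘ-/ a b-1) (toℚᵘ-/ c d-1) ⟩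
  ℚᵘ.mkℚᵘ (+ a ℤ.* + c) (ℕ.pred (b ℕ.* d))
    ≡⟨ cong (λ n → ℚᵘ.mkℚᵘ n (ℕ.pred (b ℕ.* d))) (sym (ℤ.pos-* a c)) ⟩
  ℚᵘ.mkℚᵘ (+ (a ℕ.* c)) (ℕ.pred (b ℕ.* d))          ≈⟨ toℚᵘ-/ (a ℕ.* c) (ℕ.pred (b ℕ.* d)) ⟨
  ℚ.toℚᵘ (+ (a ℕ.* c) / (b ℕ.* d))                  ∎)
  where open ℚᵘ.≃-Reasoning

/-+ : ∀ a b c d .{{_ : ℕ.NonZero b}} .{{_ : ℕ.NonZero d}} →
      (+ a / b) + (+ c / d) ≡ (+ (a ℕ.* d ℕ.+ c ℕ.* b) / (b ℕ.* d)) {{ℕ.m*n≢0 b d}}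
/-+ a b@(suc b-1) c d@(suc d-1) = ℚ.toℚᵘ-injective (begin
  ℚ.toℚᵘ ((+ a / b) + (+ c / d))                    ≈⟨ ℚ.toℚᵘ-homo-+ (+ a / b) (+ c / d) ⟩
  ℚ.toℚᵘ (+ a / b) ℚᵘ.+ ℚ.toℚᵘ (+ c / d)            ≈⟨ ℚᵘ.+-cong (toℚᵘ-/ a b-1) (toℚᵘ-/ c d-1) ⟩
  ℚᵘ.mkℚᵘ (+ a ℤ.* + d ℤ.+ + c ℤ.* + b) (ℕ.pred (b ℕ.* d))
    ≡⟨ cong (λ n → ℚᵘ.mkℚᵘ n (ℕ.pred (b ℕ.* d))) numerator ⟩
  ℚᵘ.mkℚᵘ (+ (a ℕ.* d ℕ.+ c ℕ.* b)) (ℕ.pred (b ℕ.* d))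
    ≈⟨ toℚᵘ-/ (a ℕ.* d ℕ.+ c ℕ.* b) (ℕ.pred (b ℕ.* d)) ⟨
  ℚ.toℚᵘ (+ (a ℕ.* d ℕ.+ c ℕ.* b) / (b ℕ.* d))      ∎)
  where
  open ℚᵘ.≃-Reasoning
  numerator : + a ℤ.* + d ℤ.+ + c ℤ.* + b ≡ + (a ℕ.* d ℕ.+ c ℕ.* b)
  numerator = trans (cong₂ ℤ._+_ (sym (ℤ.pos-* a d)) (sym (ℤ.pos-* c b))) (sym (ℤ.pos-+ (a ℕ.* d) (c ℕ.* b)))

/1-+ : ∀ a b → + (a ℕ.+ b) / 1 ≡ + a / 1 + + b / 1
/1-+ a b = sym (trans (/-+ a 1 b 1) (/-≡ (a ℕ.* 1 ℕ.+ b ℕ.* 1) 1 (a ℕ.+ b) 1 (solveℕ (a ∷ b ∷ []))))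

n/1*1/n≡1 : ∀ n .{{_ : ℕ.NonZero n}} → (+ n / 1) *ℚ (+ 1 / n) ≡ 1ℚ
n/1*1/n≡1 n = trans (/-* n 1 1 n) (/-≡ (n ℕ.* 1) (1 ℕ.* n) 1 1 {{ℕ.m*n≢0 1 n}} (solveℕ (n ∷ [])))

p≤q⇒0≤q-p : ∀ {p q} → p ℚ.≤ q → 0ℚ ℚ.≤ q ℚ.- p
p≤q⇒0≤q-p {p} {q} p≤q = begin
  0ℚ      ≡⟨ ℚ.+-inverseʳ p ⟨
  p ℚ.- p ≤⟨ ℚ.+-monoˡ-≤ (- p) p≤q ⟩
  q ℚ.- p ∎
  where open ℚ.≤-Reasoning

0≤q⇒p-q≤p : ∀ p {q} → 0ℚ ℚ.≤ q → p ℚ.- q ℚ.≤ p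
0≤q⇒p-q≤p p {q} 0≤q = begin
  p ℚ.- q ≤⟨ ℚ.+-monoʳ-≤ p (ℚ.neg-antimono-≤ 0≤q) ⟩
  p + 0ℚ  ≡⟨ ℚ.+-identityʳ p ⟩
  p       ∎
  where open ℚ.≤-Reasoning

p≤p+q : ∀ p {q} → 0ℚ ℚ.≤ q → p ℚ.≤ p + q
p≤p+q p {q} 0≤q = begin
  p       ≡⟨ ℚ.+-identityʳ p ⟨
  p + 0ℚ  ≤⟨ ℚ.+-monoʳ-≤ p 0≤q ⟩
  p + q   ∎
  where open ℚ.≤-Reasoning

1-cy≤y : ∀ c {x y} → (c + 1ℚ) *ℚ x ≡ 1ℚ → 0ℚ ℚ.≤ c + 1ℚ → x ℚ.≤ y → 1ℚ + - (c *ℚ y) ℚ.≤ y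
1-cy≤y c {x} {y} [c+1]x≡1 0≤c+1 x≤y = begin
  1ℚ + - (c *ℚ y)               ≡⟨ cong (λ z → z + - (c *ℚ y)) [c+1]x≡1 ⟨
  (c + 1ℚ) *ℚ x + - (c *ℚ y)
    ≤⟨ ℚ.+-monoˡ-≤ (- (c *ℚ y)) (ℚ.*-monoˡ-≤-nonNeg (c + 1ℚ) {{ℚ.nonNegative 0≤c+1}} x≤y) ⟩
  (c + 1ℚ) *ℚ y + - (c *ℚ y)    ≡⟨ solve 2 (λ c y → (c :+ con 1ℚ) :* y :+ :- (c :* y) := y) refl c y ⟩
  y                             ∎
  where open ℚ.≤-Reasoning

altSign-cases : ∀ i → altSign i ≡ 1ℚ ⊎ altSign i ≡ - 1ℚ
altSign-cases ℕ.zero    = inj₂ refl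
altSign-cases (suc i) with altSign-cases i
... | inj₁ σ≡1  = inj₂ (cong -_ σ≡1)
... | inj₂ σ≡-1 = inj₁ (cong -_ σ≡-1)

altSign-square : ∀ i → altSign i *ℚ altSign i ≡ 1ℚ
altSign-square i with altSign-cases i
... | inj₁ σ≡1  rewrite σ≡1  = refl
... | inj₂ σ≡-1 rewrite σ≡-1 = refl

altSign-*-≤ : ∀ i {x} → 0ℚ ℚ.≤ x → altSign i *ℚ x ℚ.≤ x
altSign-*-≤ i {x} 0≤x with altSign-cases i
... | inj₁ σ≡1  rewrite σ≡1  = ℚ.≤-reflexive (ℚ.*-identityˡ x)
... | inj₂ σ≡-1 rewrite σ≡-1 | sym (ℚ.neg-distribˡ-* 1ℚ x) | ℚ.*-identityˡ x =
  ℚ.≤-trans (ℚ.neg-antimono-≤ 0≤x) 0≤x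

neg-altSign-*-≤ : ∀ i {x} → 0ℚ ℚ.≤ x → - (altSign i *ℚ x) ℚ.≤ x
neg-altSign-*-≤ i {x} 0≤x rewrite ℚ.neg-distribˡ-* (altSign i) x = altSign-*-≤ (suc i) 0≤x

altSum : (ℕ → ℚ) → ℕ → ℚ
altSum a ℕ.zero    = 0ℚ
altSum a (suc n) = altSum a n + altSign (suc n) *ℚ a (suc n)

altTail : (ℕ → ℚ) → ℕ → ℕ → ℚ
altTail a p ℕ.zero    = 0ℚ
altTail a p (suc j) = altSign (suc p) *ℚ a (suc p) + altTail a (suc p) j

altSum-+ : ∀ a p j → altSum a (p ℕ.+ j) ≡ altSum a p + altTail a p j
altSum-+ a p ℕ.zero rewrite ℕ.+-identityʳ p = sym (ℚ.+-identityʳ (altSum a p))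
altSum-+ a p (suc j) rewrite ℕ.+-suc p j | altSum-+ a (suc p) j =
  ℚ.+-assoc (altSum a p) (altSign (suc p) *ℚ a (suc p)) (altTail a (suc p) j)

altSum-shift : ∀ a n → altSum a (suc n) ≡ a 1 ℚ.- altSum (a ∘ suc) n
altSum-shift a ℕ.zero = solve 1 (λ x → con 0ℚ :+ con 1ℚ :* x := x :- con 0ℚ) refl (a 1)
altSum-shift a (suc n) = begin
  altSum a (suc n) + (- σ) *ℚ x           ≡⟨ cong (_+ (- σ) *ℚ x) (altSum-shift a n) ⟩
  (a 1 ℚ.- altSum (a ∘ suc) n) + (- σ) *ℚ x ≡⟨ solve 4 (λ a₁ s σ x → (a₁ :- s) :+ (:- σ) :* x := a₁ :- (s :+ σ :* x))
                                                   refl (a 1) (altSum (a ∘ suc) n) σ x ⟩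
  a 1 ℚ.- (altSum (a ∘ suc) n + σ *ℚ x)   ∎
  where
  open ≡-Reasoning
  σ = altSign (suc n)
  x = a (suc (suc n))

altSum-scale : ∀ {a b} c → (∀ i → b i ≡ c *ℚ a i) → ∀ n → altSum b n ≡ c *ℚ altSum a n
altSum-scale c b≡ca ℕ.zero = sym (ℚ.*-zeroʳ c)
altSum-scale {a} {b} c b≡ca (suc n) = begin
  altSum b n + σ *ℚ b (suc n)             ≡⟨ cong₂ (λ s y → s + σ *ℚ y) (altSum-scale c b≡ca n) (b≡ca (suc n)) ⟩
  c *ℚ altSum a n + σ *ℚ (c *ℚ a (suc n)) ≡⟨ solve 4 (λ c s σ x → c :* s :+ σ :* (c :* x) := c :* (s :+ σ :* x))
                                                   refl c (altSum a n) σ (a (suc n)) ⟩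
  c *ℚ (altSum a n + σ *ℚ a (suc n))      ∎
  where
  open ≡-Reasoning
  σ = altSign (suc n)

module _ {a : ℕ → ℚ} (a-nonNeg : ∀ i → 0ℚ ℚ.≤ a i) (a-antitone : ∀ i → a (suc i) ℚ.≤ a i) where

  altTail-bounds : ∀ p j → 0ℚ ℚ.≤ altSign (suc p) *ℚ altTail a p j
                         × altSign (suc p) *ℚ altTail a p j ℚ.≤ a (suc p)
  altTail-bounds p ℕ.zero = ℚ.≤-reflexive (sym (ℚ.*-zeroʳ σ)) , subst (ℚ._≤ a (suc p)) (sym (ℚ.*-zeroʳ σ)) (a-nonNeg (suc p))
    where σ = altSign (suc p)
  altTail-bounds p (suc j) with altTail-bounds (suc p) j
  ... | 0≤X , X≤a = subst (0ℚ ℚ.≤_) (sym peel) (p≤q⇒0≤q-p (ℚ.≤-trans X≤a (a-antitone (suc p)))) ,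
                    subst (ℚ._≤ a (suc p)) (sym peel) (0≤q⇒p-q≤p (a (suc p)) 0≤X)
    where
    open ≡-Reasoning
    σ = altSign (suc p)
    x = a (suc p)
    t = altTail a (suc p) j
    peel : σ *ℚ (σ *ℚ x + t) ≡ x ℚ.- (- σ) *ℚ t
    peel = begin
      σ *ℚ (σ *ℚ x + t)             ≡⟨ solve 3 (λ σ x t → σ :* (σ :* x :+ t) := (σ :* σ) :* x :- (:- σ) :* t) refl σ x t ⟩
      (σ *ℚ σ) *ℚ x ℚ.- (- σ) *ℚ t  ≡⟨ cong (λ s → s *ℚ x ℚ.- (- σ) *ℚ t) (altSign-square (suc p)) ⟩
      1ℚ *ℚ x ℚ.- (- σ) *ℚ t        ≡⟨ cong (ℚ._- (- σ) *ℚ t) (ℚ.*-identityˡ x) ⟩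
      x ℚ.- (- σ) *ℚ t              ∎

  altSum-nonNeg : ∀ n → 0ℚ ℚ.≤ altSum a n
  altSum-nonNeg n = begin
    0ℚ                      ≤⟨ proj₁ (altTail-bounds 0 n) ⟩
    1ℚ *ℚ altTail a 0 n     ≡⟨ solve 1 (λ t → con 1ℚ :* t := con 0ℚ :+ t) refl (altTail a 0 n) ⟩
    0ℚ + altTail a 0 n      ≡⟨ altSum-+ a 0 n ⟨
    altSum a n              ∎
    where open ℚ.≤-Reasoning

  altSum-2≤altSum-1+n : ∀ n → altSum a 2 ℚ.≤ altSum a (suc n)
  altSum-2≤altSum-1+n n = begin
    altSum a 1 + (- 1ℚ) *ℚ a 2  ≡⟨ cong (λ y → altSum a 1 + y) (solve 1 (λ x → (:- con 1ℚ) :* x := :- x) refl (a 2)) ⟩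
    altSum a 1 + - a 2          ≤⟨ ℚ.+-monoʳ-≤ (altSum a 1) (ℚ.neg-antimono-≤ (proj₂ (altTail-bounds 1 n))) ⟩
    altSum a 1 + - ((- 1ℚ) *ℚ t) ≡⟨ cong (λ y → altSum a 1 + y) (solve 1 (λ t → :- ((:- con 1ℚ) :* t) := t) refl t) ⟩
    altSum a 1 + t              ≡⟨ altSum-+ a 1 n ⟨
    altSum a (suc n)            ∎
    where
    open ℚ.≤-Reasoning
    t = altTail a 1 n

  altSum-2+n≤altSum-2+a3 : ∀ n → altSum a (2 ℕ.+ n) ℚ.≤ altSum a 2 + a 3
  altSum-2+n≤altSum-2+a3 n = begin
    altSum a (2 ℕ.+ n)    ≡⟨ altSum-+ a 2 n ⟩
    altSum a 2 + t        ≡⟨ cong (λ y → altSum a 2 + y) (ℚ.*-identityˡ t) ⟨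
    altSum a 2 + 1ℚ *ℚ t  ≤⟨ ℚ.+-monoʳ-≤ (altSum a 2) (proj₂ (altTail-bounds 2 n)) ⟩
    altSum a 2 + a 3      ∎
    where
    open ℚ.≤-Reasoning
    t = altTail a 2 n

harmonic-eventually-≤ : ∀ ε → ℚ.Positive ε → ∀ C → ∃ λ M → ∀ n → n ℕ.≥ M → + C / suc n ℚ.≤ ε
harmonic-eventually-≤ ε@(ℚ.mkℚ (+ suc p) q _) _ C = C ℕ.* suc q , λ n n≥M →
  subst (+ C / suc n ℚ.≤_) (ℚ.↥p/↧p≡p ε)
    (/-≤ C (suc n) (suc p) (suc q) (ℕ.≤-trans n≥M (ℕ.≤-trans (ℕ.n≤1+n n) (ℕ.m≤m+n (suc n) (p ℕ.* suc n)))))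

≤-eventually⇒LimLe : ∀ {a} b N → (∀ n → n ℕ.≥ N → a n ℚ.≤ b n) → LimLe a b
≤-eventually⇒LimLe b N a≤b ε ε>0 =
  N , λ n n≥N → ℚ.≤-trans (a≤b n n≥N) (p≤p+q (b n) (ℚ.<⇒≤ (ℚ.positive⁻¹ ε {{ε>0}})))

≤+harmonic⇒LimLe : ∀ {a} b C → (∀ n → a n ℚ.≤ b n + + C / suc n) → LimLe a b
≤+harmonic⇒LimLe b C a≤b+C/n ε ε>0 with harmonic-eventually-≤ ε ε>0 C
... | M , C/n≤ε = M , λ n n≥M → ℚ.≤-trans (a≤b+C/n n) (ℚ.+-monoʳ-≤ (b n) (C/n≤ε n n≥M))

!-+-suc : ∀ m i → (m ℕ.+ suc i) ! ≡ suc (m ℕ.+ i) ℕ.* (m ℕ.+ i) !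
!-+-suc m i = cong _! (ℕ.+-suc m i)

m!≤[m+i]! : ∀ m i → m ! ℕ.≤ (m ℕ.+ i) !
m!≤[m+i]! m ℕ.zero rewrite ℕ.+-identityʳ m = ℕ.≤-refl
m!≤[m+i]! m (suc i) rewrite !-+-suc m i = ℕ.≤-trans (m!≤[m+i]! m i) (ℕ.m≤n*m ((m ℕ.+ i) !) (suc (m ℕ.+ i)))

ratio : ℕ → ℕ → ℚ
ratio m i = (+ (m !) / (m ℕ.+ i) !) {{(m ℕ.+ i) !≢0}}

ratio-nonNeg : ∀ m i → 0ℚ ℚ.≤ ratio m i
ratio-nonNeg m i = ℚ.nonNegative⁻¹ (ratio m i) {{ℚ.normalize-nonNeg (m !) ((m ℕ.+ i) !) {{(m ℕ.+ i) !≢0}}}}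

ratio-antitone : ∀ m i → ratio m (suc i) ℚ.≤ ratio m i
ratio-antitone m i = /-≤ (m !) ((m ℕ.+ suc i) !) (m !) ((m ℕ.+ i) !) {{(m ℕ.+ suc i) !≢0}} {{(m ℕ.+ i) !≢0}}
  (ℕ.*-monoʳ-≤ (m !) (subst ((m ℕ.+ i) ! ℕ.≤_) (sym (!-+-suc m i)) (ℕ.m≤n*m ((m ℕ.+ i) !) (suc (m ℕ.+ i)))))

ratio-≤-harmonic : ∀ m n → ratio m (suc n) ℚ.≤ + 1 / suc n
ratio-≤-harmonic m n = /-≤ (m !) ((m ℕ.+ suc n) !) 1 (suc n) {{(m ℕ.+ suc n) !≢0}} (begin
  m ! ℕ.* suc n                    ≡⟨ ℕ.*-comm (m !) (suc n) ⟩
  suc n ℕ.* m !                    ≤⟨ ℕ.*-mono-≤ (ℕ.s≤s (ℕ.m≤n+m n m)) (m!≤[m+i]! m n) ⟩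
  suc (m ℕ.+ n) ℕ.* (m ℕ.+ n) !    ≡⟨ !-+-suc m n ⟨
  (m ℕ.+ suc n) !                  ≡⟨ ℕ.*-identityˡ _ ⟨
  1 ℕ.* (m ℕ.+ suc n) !            ∎)
  where open ℕ.≤-Reasoning

ratio-one : ∀ m → ratio m 1 ≡ + 1 / suc m
ratio-one m = /-≡ (m !) ((m ℕ.+ 1) !) 1 (suc m) {{(m ℕ.+ 1) !≢0}} (begin
  m ! ℕ.* suc m          ≡⟨ ℕ.*-comm (m !) (suc m) ⟩
  suc m ℕ.* m !          ≡⟨ cong _! (ℕ.+-comm 1 m) ⟩
  (m ℕ.+ 1) !            ≡⟨ ℕ.*-identityˡ _ ⟨
  1 ℕ.* (m ℕ.+ 1) !      ∎)
  where open ≡-Reasoning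

ratio-suc : ∀ m i → ratio (suc m) i ≡ (+ suc m / 1) *ℚ ratio m (suc i)
ratio-suc m i = sym (trans (/-* (suc m) 1 (m !) ((m ℕ.+ suc i) !) {{_}} {{(m ℕ.+ suc i) !≢0}})
  (/-≡ (suc m ℕ.* m !) (1 ℕ.* (m ℕ.+ suc i) !) (suc m !) ((suc m ℕ.+ i) !)
       {{ℕ.m*n≢0 1 ((m ℕ.+ suc i) !) {{_}} {{(m ℕ.+ suc i) !≢0}}}} {{(suc m ℕ.+ i) !≢0}}
       (cong (suc m ℕ.* m ! ℕ.*_) (trans (cong _! (sym (ℕ.+-suc m i))) (sym (ℕ.*-identityˡ _))))))

ratio-step : ∀ m i → ratio m i ≡ (+ suc (m ℕ.+ i) / 1) *ℚ ratio m (suc i)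
ratio-step m i = sym (trans (/-* (suc (m ℕ.+ i)) 1 (m !) ((m ℕ.+ suc i) !) {{_}} {{(m ℕ.+ suc i) !≢0}})
  (/-≡ (suc (m ℕ.+ i) ℕ.* m !) (1 ℕ.* (m ℕ.+ suc i) !) (m !) ((m ℕ.+ i) !)
       {{ℕ.m*n≢0 1 ((m ℕ.+ suc i) !) {{_}} {{(m ℕ.+ suc i) !≢0}}}} {{(m ℕ.+ i) !≢0}} cross))
  where
  open ≡-Reasoning
  cross : suc (m ℕ.+ i) ℕ.* m ! ℕ.* (m ℕ.+ i) ! ≡ m ! ℕ.* (1 ℕ.* (m ℕ.+ suc i) !)
  cross = begin
    suc (m ℕ.+ i) ℕ.* m ! ℕ.* (m ℕ.+ i) !   ≡⟨ rearrange (suc (m ℕ.+ i)) (m !) ((m ℕ.+ i) !) ⟩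
    m ! ℕ.* (1 ℕ.* (suc (m ℕ.+ i) ℕ.* (m ℕ.+ i) !)) ≡⟨ cong (λ f → m ! ℕ.* (1 ℕ.* f)) (!-+-suc m i) ⟨
    m ! ℕ.* (1 ℕ.* (m ℕ.+ suc i) !)         ∎
    where
    rearrange : ∀ a b c → a ℕ.* b ℕ.* c ≡ b ℕ.* (1 ℕ.* (a ℕ.* c))
    rearrange = solve-∀

ratio-three : ∀ m → ratio m 3 ≡ + 1 / (suc m ℕ.* (suc (suc m) ℕ.* suc (suc (suc m))))
ratio-three m = /-≡ (m !) ((m ℕ.+ 3) !) 1 _ {{(m ℕ.+ 3) !≢0}}
  (trans (expand m (m !)) (cong (λ k → 1 ℕ.* k !) (ℕ.+-comm 3 m)))
  where
  expand : ∀ m f → f ℕ.* (suc m ℕ.* (suc (suc m) ℕ.* suc (suc (suc m))))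
                 ≡ 1 ℕ.* (suc (suc (suc m)) ℕ.* (suc (suc m) ℕ.* (suc m ℕ.* f)))
  expand = solve-∀

hPartial≡altSum : ∀ m n → hPartial (suc (suc m)) n ≡ altSum (ratio m) n
hPartial≡altSum m ℕ.zero    = refl
hPartial≡altSum m (suc n) = cong (_+ altSign (suc n) *ℚ ratio m (suc n)) (hPartial≡altSum m n)

altSum-ratio-recurrence : ∀ m n → altSum (ratio (suc m)) n ≡ 1ℚ + - ((+ suc m / 1) *ℚ altSum (ratio m) (suc n))
altSum-ratio-recurrence m n = begin
  altSum (ratio (suc m)) n                    ≡⟨ altSum-scale c (ratio-suc m) n ⟩
  c *ℚ altSum (ratio m ∘ suc) n               ≡⟨ solve 3 (λ c r s → c :* s := c :* r :+ :- (c :* (r :- s))) refl c r₁ _ ⟩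
  c *ℚ r₁ + - (c *ℚ (r₁ ℚ.- altSum (ratio m ∘ suc) n))
    ≡⟨ cong₂ (λ u v → u + - (c *ℚ v)) c*ratio-one (sym (altSum-shift (ratio m) n)) ⟩
  1ℚ + - (c *ℚ altSum (ratio m) (suc n))      ∎
  where
  open ≡-Reasoning
  c = + suc m / 1
  r₁ = ratio m 1
  c*ratio-one : c *ℚ r₁ ≡ 1ℚ
  c*ratio-one = trans (cong (c *ℚ_) (ratio-one m)) (n/1*1/n≡1 (suc m))

altSum-ratio-two : ∀ m → altSum (ratio m) 2 ≡ + 1 / suc (suc m)
altSum-ratio-two m = begin
  0ℚ + 1ℚ *ℚ r₁ + (- 1ℚ) *ℚ r₂
    ≡⟨ solve 2 (λ r₁ r₂ → con 0ℚ :+ con 1ℚ :* r₁ :+ (:- con 1ℚ) :* r₂ := r₁ :- r₂) refl r₁ r₂ ⟩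
  r₁ ℚ.- r₂                           ≡⟨ cong (ℚ._- r₂) (trans (ratio-step m 1) (cong (_*ℚ r₂) (/1-+ (suc m) 1))) ⟩
  (c + 1ℚ) *ℚ r₂ ℚ.- r₂               ≡⟨ solve 2 (λ c r → (c :+ con 1ℚ) :* r :- r := c :* r) refl c r₂ ⟩
  c *ℚ r₂                             ≡⟨ ratio-suc m 1 ⟨
  ratio (suc m) 1                     ≡⟨ ratio-one (suc m) ⟩
  + 1 / suc (suc m)                   ∎
  where
  open ≡-Reasoning
  c = + suc m / 1
  r₁ = ratio m 1
  r₂ = ratio m 2

hPartial-suc-≤-hPartial+1/n : ∀ m n → hPartial (suc (suc (suc m))) n ℚ.≤ hPartial (suc (suc m)) n + + 1 / suc n
hPartial-suc-≤-hPartial+1/n m n rewrite hPartial≡altSum (suc m) n | hPartial≡altSum m n = begin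
  altSum (ratio (suc m)) n                     ≡⟨ altSum-ratio-recurrence m n ⟩
  1ℚ + - (c *ℚ altSum (ratio m) (suc n))
    ≤⟨ 1-cy≤y c [c+1]*P₂≡1 0≤c+1 (altSum-2≤altSum-1+n (ratio-nonNeg m) (ratio-antitone m) n) ⟩
  altSum (ratio m) (suc n)                     ≤⟨ ℚ.+-monoʳ-≤ (altSum (ratio m) n) (altSign-*-≤ (suc n) (ratio-nonNeg m (suc n))) ⟩
  altSum (ratio m) n + ratio m (suc n)         ≤⟨ ℚ.+-monoʳ-≤ (altSum (ratio m) n) (ratio-≤-harmonic m n) ⟩
  altSum (ratio m) n + + 1 / suc n             ∎
  where
  open ℚ.≤-Reasoning
  c = + suc m / 1
  c+1≡m+2 : c + 1ℚ ≡ + suc (suc m) / 1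
  c+1≡m+2 = trans (sym (/1-+ (suc m) 1)) (cong (λ k → + k / 1) (ℕ.+-comm (suc m) 1))
  [c+1]*P₂≡1 : (c + 1ℚ) *ℚ altSum (ratio m) 2 ≡ 1ℚ
  [c+1]*P₂≡1 = trans (cong₂ _*ℚ_ c+1≡m+2 (altSum-ratio-two m)) (n/1*1/n≡1 (suc (suc m)))
  0≤c+1 : 0ℚ ℚ.≤ c + 1ℚ
  0≤c+1 = subst (0ℚ ℚ.≤_) (sym c+1≡m+2) (ℚ.nonNegative⁻¹ _ {{ℚ.normalize-nonNeg (suc (suc m)) 1}})

hPartial-suc-≤-1-[k∸1]hPartial+[k∸1]/n : ∀ m n → hPartial (suc (suc (suc m))) n
                              ℚ.≤ (1ℚ + - ((+ suc m / 1) *ℚ hPartial (suc (suc m)) n)) + + suc m / suc n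
hPartial-suc-≤-1-[k∸1]hPartial+[k∸1]/n m n rewrite hPartial≡altSum (suc m) n | hPartial≡altSum m n = begin
  altSum (ratio (suc m)) n                ≡⟨ altSum-ratio-recurrence m n ⟩
  1ℚ + - (c *ℚ (S + σ *ℚ r))
    ≡⟨ solve 4 (λ c s σ r → con 1ℚ :+ :- (c :* (s :+ σ :* r)) := (con 1ℚ :+ :- (c :* s)) :+ :- (σ :* (c :* r)))
               refl c S σ r ⟩
  (1ℚ + - (c *ℚ S)) + - (σ *ℚ (c *ℚ r))   ≤⟨ ℚ.+-monoʳ-≤ (1ℚ + - (c *ℚ S)) (neg-altSign-*-≤ (suc n) 0≤cr) ⟩
  (1ℚ + - (c *ℚ S)) + c *ℚ r
    ≤⟨ ℚ.+-monoʳ-≤ (1ℚ + - (c *ℚ S)) (ℚ.*-monoˡ-≤-nonNeg c {{c-nonNeg}} (ratio-≤-harmonic m n)) ⟩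
  (1ℚ + - (c *ℚ S)) + c *ℚ (+ 1 / suc n)  ≡⟨ cong (λ x → (1ℚ + - (c *ℚ S)) + x) c*1/n≡c/n ⟩
  (1ℚ + - (c *ℚ S)) + + suc m / suc n     ∎
  where
  open ℚ.≤-Reasoning
  c = + suc m / 1
  S = altSum (ratio m) n
  σ = altSign (suc n)
  r = ratio m (suc n)
  c-nonNeg : ℚ.NonNegative c
  c-nonNeg = ℚ.normalize-nonNeg (suc m) 1
  0≤cr : 0ℚ ℚ.≤ c *ℚ r
  0≤cr = ℚ.nonNegative⁻¹ _ {{ℚ.nonNeg*nonNeg⇒nonNeg c {{c-nonNeg}} r {{ℚ.nonNegative (ratio-nonNeg m (suc n))}}}}
  c*1/n≡c/n : c *ℚ (+ 1 / suc n) ≡ + suc m / suc n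
  c*1/n≡c/n = trans (/-* (suc m) 1 1 (suc n)) (/-≡ (suc m ℕ.* 1) (1 ℕ.* suc n) (suc m) (suc n) (solveℕ (m ∷ n ∷ [])))

hPartial-nonNeg : ∀ m n → 0ℚ ℚ.≤ hPartial (suc (suc m)) n
hPartial-nonNeg m n rewrite hPartial≡altSum m n = altSum-nonNeg (ratio-nonNeg m) (ratio-antitone m) n

hPartial-≤-k/[k²-k+1] : ∀ m n → n ℕ.≥ 2 → hPartial (suc (suc m)) n ℚ.≤ + suc (suc m) / suc (suc m ℕ.* suc (suc m))
hPartial-≤-k/[k²-k+1] m (suc ℕ.zero) (ℕ.s≤s ())
hPartial-≤-k/[k²-k+1] m (suc (suc j)) _ rewrite hPartial≡altSum m (suc (suc j)) = begin
  altSum (ratio m) (2 ℕ.+ j)                ≤⟨ altSum-2+n≤altSum-2+a3 (ratio-nonNeg m) (ratio-antitone m) j ⟩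
  altSum (ratio m) 2 + ratio m 3            ≡⟨ cong₂ _+_ (altSum-ratio-two m) (ratio-three m) ⟩
  + 1 / k + + 1 / D                         ≡⟨ /-+ 1 k 1 D ⟩
  + (1 ℕ.* D ℕ.+ 1 ℕ.* k) / (k ℕ.* D)
    ≤⟨ /-≤ (1 ℕ.* D ℕ.+ 1 ℕ.* k) (k ℕ.* D) k (suc (suc m ℕ.* k))
           (ℕ.≤-trans (ℕ.m≤m+n _ _) (ℕ.≤-reflexive (sym (gap m)))) ⟩
  + k / suc (suc m ℕ.* k)                   ∎
  where
  open ℚ.≤-Reasoning
  k = suc (suc m)
  D = suc m ℕ.* (k ℕ.* suc k)
  gap : ∀ m → suc (suc m) ℕ.* (suc (suc m) ℕ.* (suc m ℕ.* (suc (suc m) ℕ.* suc (suc (suc m)))))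
            ≡ (1 ℕ.* (suc m ℕ.* (suc (suc m) ℕ.* suc (suc (suc m)))) ℕ.+ 1 ℕ.* suc (suc m)) ℕ.* suc (suc m ℕ.* suc (suc m))
              ℕ.+ suc (suc m) ℕ.* suc (suc m) ℕ.* suc (suc m) ℕ.* m
  gap = solve-∀

proposition20 : (k : ℕ) → 2 ≤ k →
    LimLe (hPartial (suc k)) (hPartial k)
    × (LimLe (const 0ℚ) (hPartial k)
    × LimLe (hPartial k) (const ((+ k) / suc ((k ∸ 1) * k))))
    × LimLe (hPartial (suc k)) (λ n → 1ℚ + - ((+ (k ∸ 1) / 1) *ℚ hPartial k n))
proposition20 k@(suc (suc m)) (ℕ.s≤s (ℕ.s≤s ℕ.z≤n)) =
  ≤+harmonic⇒LimLe (hPartial k) 1 (hPartial-suc-≤-hPartial+1/n m) ,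
  (≤-eventually⇒LimLe (hPartial k) 0 (λ n _ → hPartial-nonNeg m n) , ≤-eventually⇒LimLe _ 2 (hPartial-≤-k/[k²-k+1] m)) ,
  ≤+harmonic⇒LimLe (λ n → 1ℚ + - ((+ suc m / 1) *ℚ hPartial k n)) (suc m) (hPartial-suc-≤-1-[k∸1]hPartial+[k∸1]/n m)
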